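{- Let $\mathcal D$ be a maximal ASPD on a finite set $A$ with $n=|A|$, and let $\mathcal V=\{\{\omega(1),\dots,\omega(k)\}:\omega\in\mathcal D,\ 1\le k\le n\}$, ordered by inclusion. Then for each $a\in A$, the number $t_a=|\{\omega\in\mathcal D:\omega(1)=a\}|$ equals the number of maximal chains of $\mathcal V$ whose minimal element is $\{a\}$.
   Context: Preferences: bijections $\omega\colon[n]\to A$, written $\omega(1)\cdots\omega(n)$ ($\omega(1)$ most preferred); $\mathcal L(A)$ all preferences; domain = subset of $\mathcal L(A)$; $\mathcal D_S$ = restrictions to $S\subseteq A$ keeping relative order; $x$ is a bottom alternative of $\mathcal D$ if $\omega(|A|)=x$ for some $\omega\in\mathcal D$. ASPD: for every 3-element $T\subseteq A$ some $x\in T$ is not a bottom alternative of $\mathcal D_T$; maximal: not properly contained in another ASPD in $\mathcal L(A)$. ($\mathcal V$ is the regular vine corresponding to $\mathcal D$.) -}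

module Defs where

open import Data.Nat using (ℕ; zero; suc; _≤_)
open import Data.Fin using (Fin)
open import Data.Fin.Properties using (_≟_)
open import Data.Fin.Subset using (Subset; ⁅_⁆; _∪_; _⊂_) renaming (⊥ to ∅)
open import Data.List using (List; []; _∷_; _++_; [_]; length; filter; take; foldr)
open import Data.List.Membership.Propositional using (_∈_)
open import Data.List.Relation.Unary.Unique.Propositional using (Unique)
open import Data.List.Relation.Unary.Linked using (Linked)
open import Data.Product using (Σ; ∃; ∃-syntax; _×_)
open import Relation.Binary.PropositionalEquality using (_≡_; _≢_)
open import Relation.Nullary using (¬_; yes; no)
open import Function.Bundles using (_⇔_)
import Data.List.Membership.DecPropositional as DecMem

-- The set of alternatives is A = Fin n (so n = |A|).
-- A preference ω is written as the list ω(1) ω(2) … ω(n) (ω(1) most preferred);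
-- it is a bijection [n] → A exactly when it has length n and no repetitions.
Pref : ℕ → Set
Pref n = List (Fin n)

IsPref : {n : ℕ} → Pref n → Set
IsPref {n} ω = length ω ≡ n × Unique ω

Domain : ℕ → Set
Domain n = List (Pref n)

IsDomain : {n : ℕ} → Domain n → Set
IsDomain D = (∀ ω → ω ∈ D → IsPref ω)

_⊆D_ : {n : ℕ} → Domain n → Domain n → Set
D ⊆D D' = ∀ ω → ω ∈ D → ω ∈ D'

restrict : {n : ℕ} → List (Fin n) → Pref n → Pref n
restrict S ω = filter (λ y → DecMem._∈?_ _≟_ y S) ω

IsBottomOfRestriction : {n : ℕ} → Domain n → List (Fin n) → Fin n → Set
IsBottomOfRestriction D T x =
  ∃[ ω ] (ω ∈ D × ∃[ pre ] (restrict T ω ≡ pre ++ [ x ]))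

IsASPD : {n : ℕ} → Domain n → Set
IsASPD {n} D =
  (x y z : Fin n) → x ≢ y → x ≢ z → y ≢ z →
  ∃[ w ] (w ∈ (x ∷ y ∷ z ∷ []) × ¬ IsBottomOfRestriction D (x ∷ y ∷ z ∷ []) w)

IsMaximalASPD : {n : ℕ} → Domain n → Set
IsMaximalASPD D =
  IsDomain D × IsASPD D ×
  (∀ D' → IsDomain D' → IsASPD D' → D ⊆D D' → D' ⊆D D)

toSubset : {n : ℕ} → List (Fin n) → Subset n
toSubset = foldr (λ x S → ⁅ x ⁆ ∪ S) ∅

InV : {n : ℕ} → Domain n → Subset n → Set
InV {n} D S = ∃[ ω ] (ω ∈ D × ∃[ k ] (1 ≤ k × k ≤ n × S ≡ toSubset (take k ω)))

-- A chain of (𝒱, ⊆) is a finite totally ordered subset of 𝒱; we represent it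
-- canonically by listing its elements in strictly increasing order.
IsChain : {n : ℕ} → Domain n → List (Subset n) → Set
IsChain D c = (∀ S → S ∈ c → InV D S) × Linked _⊂_ c

IsMaximalChain : {n : ℕ} → Domain n → List (Subset n) → Set
IsMaximalChain D c =
  IsChain D c ×
  (∀ c' → IsChain D c' → (∀ S → S ∈ c → S ∈ c') → ∀ S → S ∈ c' → S ∈ c)

-- Maximal chain whose minimal element is {a} (the first entry of the increasing list).
IsMaximalChainFrom : {n : ℕ} → Domain n → Fin n → List (Subset n) → Set
IsMaximalChainFrom D a c = IsMaximalChain D c × ∃[ rest ] (c ≡ ⁅ a ⁆ ∷ rest)

-- t_a = |{ω ∈ D : ω(1) = a}|  (D is duplicate-free, so counting list entries).
topCount : {n : ℕ} → Fin n → Domain n → ℕ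
topCount a [] = 0
topCount a ([] ∷ D) = topCount a D
topCount a ((x ∷ _) ∷ D) with x ≟ a
... | yes _ = suc (topCount a D)
... | no _ = topCount a D

HasCount : {X : Set} → (X → Set) → ℕ → Set
HasCount {X} P k = Σ (List X) (λ L → Unique L × (∀ x → (x ∈ L ⇔ P x)) × length L ≡ k)

{-# OPTIONS --safe #-}
-- A maximal ASPD D is closed under grafting: for ω, ν ∈ D and k ≤ n, the
-- preference listing the top k alternatives of ν in the order of ω, followed by the rest
-- of ν in the order of ν, again lies in D, because on every set X its bottom alternative
-- is the bottom alternative of ω|X or of ν|X, so adding it keeps the domain an ASPD.
-- Grafting along the members of a chain of 𝒱, smallest first, yields one ω ∈ D whose
-- flag {ω(1)} ⊂ {ω(1),ω(2)} ⊂ … contains the whole chain. Since members of 𝒱 of equal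
-- size are incomparable, every flag is a maximal chain, so the maximal chains are exactly
-- the flags of the members of D. Distinct preferences have distinct flags, and the flag
-- of ω starts at {a} iff ω(1) = a; hence ω ↦ flag ω enumerates the maximal chains from {a}.
module Submission where

open import Defs
open import Data.Nat using (ℕ; suc; _≤_; _+_; z≤n; s≤s)
open import Data.Nat.Properties using (≤-antisym; <-irrefl; m≤n⇒m⊓n≡m)
open import Data.Fin using (Fin)
open import Data.Fin.Properties using (_≟_)
open import Data.Fin.Subset using (Subset; ⁅_⁆; _∪_; _⊆_; _⊂_)
  renaming (_∈_ to _∈ₛ_; _∉_ to _∉ₛ_)
open import Data.Fin.Subset.Properties
  using (x∈⁅x⁆; x∈⁅y⁆⇒x≡y; x≢y⇒x∉⁅y⁆; ∉⊥; x∈p∪q⁺; x∈p∪q⁻; p⊆p∪q; ∪-identityʳ;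
         ⊆-reflexive; ⊆-antisym; ⊂-irref; ⊂-trans)
open import Data.List
  using (List; []; _∷_; _++_; [_]; _∷ʳ_; length; map; filter; take; drop; initLast; _∷ʳ′_)
open import Data.List.Properties
  using (∷-injective; ∷ʳ-injectiveʳ; ++-assoc; ++-identityʳ; length-++; length-++-sucʳ;
         length-++-≤ˡ; length-map; length-take; length-tabulate; take++drop≡id; filter-++; filter-all)
open import Data.List.Membership.Propositional using (_∈_)
open import Data.List.Membership.Propositional.Properties
  using (∈-∃++; ∈-++⁺ˡ; ∈-++⁺ʳ; ∈-++⁻; ∈-map⁺; ∈-map⁻; ∈-filter⁺; ∈-filter⁻; ∈-allFin)
import Data.List.Membership.DecPropositional as DecMembership
open import Data.List.Relation.Binary.Subset.Propositional using () renaming (_⊆_ to _⊆ˡ_)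
open import Data.List.Relation.Binary.Disjoint.Propositional using (Disjoint)
open import Data.List.Relation.Unary.Any using (here; there)
open import Data.List.Relation.Unary.All as All using (All; []; _∷_)
open import Data.List.Relation.Unary.All.Properties using (¬Any⇒All¬) renaming (map⁺ to All-map⁺)
open import Data.List.Relation.Unary.AllPairs using (AllPairs; []; _∷_)
open import Data.List.Relation.Unary.Linked using (Linked; []; [-]; _∷_)
open import Data.List.Relation.Unary.Linked.Properties using (Linked⇒AllPairs)
open import Data.List.Relation.Unary.Unique.Propositional using (Unique)
import Data.List.Relation.Unary.Unique.Propositional.Properties as Unique
open import Data.Product using (∃₂; ∃-syntax; _×_; _,_; proj₁; proj₂)
open import Data.Sum using (_⊎_; inj₁; inj₂; [_,_]′) renaming (map to ⊎-map)
open import Data.Empty using (⊥-elim)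
open import Function using (_∘_; id)
open import Function.Bundles using (mk⇔)
open import Relation.Binary using (Irreflexive; Transitive)
open import Relation.Binary.PropositionalEquality
  using (_≡_; _≢_; refl; sym; trans; cong; cong₂; subst; module ≡-Reasoning)
open import Relation.Nullary using (¬_; yes; no)
open import Relation.Nullary.Decidable using (map′)
open import Relation.Unary using (Decidable)

module _ {A : Set} where

  Unique-⊆⇒length≤ : ∀ {xs ys : List A} → Unique xs → xs ⊆ˡ ys → length xs ≤ length ys
  Unique-⊆⇒length≤ {[]} [] _ = z≤n
  Unique-⊆⇒length≤ {x ∷ xs} (x∉xs ∷ u) xs⊆ys with ∈-∃++ (xs⊆ys (here refl))
  ... | ys₁ , ys₂ , refl =
    subst (suc (length xs) ≤_) (sym (length-++-sucʳ ys₁ x ys₂))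
      (s≤s (Unique-⊆⇒length≤ u xs⊆ys₁ys₂))
    where
    xs⊆ys₁ys₂ : xs ⊆ˡ ys₁ ++ ys₂
    xs⊆ys₁ys₂ {y} y∈xs with ∈-++⁻ ys₁ (xs⊆ys (there y∈xs))
    ... | inj₁ y∈ys₁ = ∈-++⁺ˡ y∈ys₁
    ... | inj₂ (here refl) = ⊥-elim (All.lookup x∉xs y∈xs refl)
    ... | inj₂ (there y∈ys₂) = ∈-++⁺ʳ ys₁ y∈ys₂

  Unique-++⇒Disjoint : ∀ {xs ys : List A} → Unique (xs ++ ys) → Disjoint xs ys
  Unique-++⇒Disjoint {x ∷ xs} (x∉ ∷ _) (here refl , v∈ys) = All.lookup x∉ (∈-++⁺ʳ xs v∈ys) refl
  Unique-++⇒Disjoint {x ∷ xs} (_ ∷ u) (there v∈xs , v∈ys) = Unique-++⇒Disjoint u (v∈xs , v∈ys)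

  length-take-≤ : ∀ k (xs : List A) → k ≤ length xs → length (take k xs) ≡ k
  length-take-≤ k xs k≤ = trans (length-take k xs) (m≤n⇒m⊓n≡m k≤)

  take-length-++ : ∀ (xs ys : List A) → take (length xs) (xs ++ ys) ≡ xs
  take-length-++ [] ys = refl
  take-length-++ (x ∷ xs) ys = cong (x ∷_) (take-length-++ xs ys)

  ++-∷ʳ-suffix : ∀ (xs ys zs : List A) {w} → xs ++ ys ≡ zs ∷ʳ w →
    ys ≡ [] ⊎ ∃[ ys′ ] ys ≡ ys′ ∷ʳ w
  ++-∷ʳ-suffix xs ys zs eq with initLast ys
  ... | [] = inj₁ refl
  ... | ys′ ∷ʳ′ y =
    inj₂ (ys′ , cong (ys′ ∷ʳ_) (∷ʳ-injectiveʳ (xs ++ ys′) zs (trans (++-assoc xs ys′ [ y ]) eq)))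

  AllPairs⇒comparable : ∀ {R : A → A → Set} {xs a b} → AllPairs R xs → a ∈ xs → b ∈ xs →
    a ≡ b ⊎ R a b ⊎ R b a
  AllPairs⇒comparable (_ ∷ _) (here refl) (here refl) = inj₁ refl
  AllPairs⇒comparable (Rx ∷ _) (here refl) (there b∈) = inj₂ (inj₁ (All.lookup Rx b∈))
  AllPairs⇒comparable (Rx ∷ _) (there a∈) (here refl) = inj₂ (inj₂ (All.lookup Rx a∈))
  AllPairs⇒comparable (_ ∷ Rxs) (there a∈) (there b∈) = AllPairs⇒comparable Rxs a∈ b∈

module _ {A : Set} {P Q : A → Set} (P? : Decidable P) (Q? : Decidable Q) where

  filter-filter : (∀ {x} → P x → Q x) → ∀ xs → filter P? (filter Q? xs) ≡ filter P? xs
  filter-filter P⇒Q [] = refl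
  filter-filter P⇒Q (x ∷ xs) with Q? x
  ... | yes _ with P? x
  ...   | yes _ = cong (x ∷_) (filter-filter P⇒Q xs)
  ...   | no _ = filter-filter P⇒Q xs
  filter-filter P⇒Q (x ∷ xs) | no ¬qx with P? x
  ...   | yes px = ⊥-elim (¬qx (P⇒Q px))
  ...   | no _ = filter-filter P⇒Q xs

module _ {A : Set} {_<_ : A → A → Set} (irrefl : Irreflexive _≡_ _<_) (transitive : Transitive _<_) where

  private
    least-≡ : ∀ {x y xs ys} → All (x <_) xs → All (y <_) ys → x ∈ y ∷ ys → y ∈ x ∷ xs → x ≡ y
    least-≡ _ _ (here x≡y) _ = x≡y
    least-≡ _ _ (there _) (here y≡x) = sym y≡x
    least-≡ x<xs y<ys (there x∈ys) (there y∈xs) =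
      ⊥-elim (irrefl refl (transitive (All.lookup y<ys x∈ys) (All.lookup x<xs y∈xs)))

    drop-least : ∀ {x xs ys} → All (x <_) xs → (∀ z → z ∈ xs → z ∈ x ∷ ys) →
      ∀ z → z ∈ xs → z ∈ ys
    drop-least x<xs xs⊆ z z∈xs with xs⊆ z z∈xs
    ... | here refl = ⊥-elim (irrefl refl (All.lookup x<xs z∈xs))
    ... | there z∈ys = z∈ys

  strictlySorted-≡ : ∀ {xs ys} → AllPairs _<_ xs → AllPairs _<_ ys →
    (∀ z → z ∈ xs → z ∈ ys) → (∀ z → z ∈ ys → z ∈ xs) → xs ≡ ys
  strictlySorted-≡ {[]} {[]} _ _ _ _ = refl
  strictlySorted-≡ {[]} {y ∷ _} _ _ _ ys⊆ with ys⊆ y (here refl)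
  ... | ()
  strictlySorted-≡ {x ∷ _} {[]} _ _ xs⊆ _ with xs⊆ x (here refl)
  ... | ()
  strictlySorted-≡ {x ∷ xs} {y ∷ ys} (x<xs ∷ sxs) (y<ys ∷ sys) xs⊆ ys⊆
    with least-≡ x<xs y<ys (xs⊆ x (here refl)) (ys⊆ y (here refl))
  ... | refl = cong (x ∷_) (strictlySorted-≡ sxs sys
                 (drop-least x<xs (λ z → xs⊆ z ∘ there)) (drop-least y<ys (λ z → ys⊆ z ∘ there)))

module _ {A B : Set} {P : A → Set} {f : A → B}
         (injective : ∀ {x y} → P x → P y → f x ≡ f y → x ≡ y) where

  map-injective-on : ∀ {xs ys} → All P xs → All P ys → map f xs ≡ map f ys → xs ≡ ys
  map-injective-on [] [] _ = refl
  map-injective-on (px ∷ pxs) (py ∷ pys) eq with ∷-injective eq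
  ... | fx≡fy , eq′ = cong₂ _∷_ (injective px py fx≡fy) (map-injective-on pxs pys eq′)

  Unique-map⁺-on : ∀ {xs} → All P xs → Unique xs → Unique (map f xs)
  Unique-map⁺-on [] [] = []
  Unique-map⁺-on (px ∷ pxs) (x∉xs ∷ u) =
    All-map⁺ (All.zipWith (λ (py , x≢y) → x≢y ∘ injective px py) (pxs , x∉xs))
    ∷ Unique-map⁺-on pxs u

module _ {n : ℕ} where

  open DecMembership (_≟_ {n}) using (_∈?_)

  IsPref⇒∈ : ∀ {ω : Pref n} → IsPref ω → ∀ x → x ∈ ω
  IsPref⇒∈ {ω} (length≡n , u) x with x ∈? ω
  ... | yes x∈ω = x∈ω
  ... | no x∉ω = ⊥-elim (<-irrefl (trans length≡n (sym (length-tabulate {n = n} id)))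
                          (Unique-⊆⇒length≤ (¬Any⇒All¬ ω x∉ω ∷ u) (λ {y} _ → ∈-allFin y)))

  ∈-toSubset⁺ : ∀ {x : Fin n} {xs} → x ∈ xs → x ∈ₛ toSubset xs
  ∈-toSubset⁺ {xs = y ∷ _} (here refl) = x∈p∪q⁺ (inj₁ (x∈⁅x⁆ y))
  ∈-toSubset⁺ (there x∈xs) = x∈p∪q⁺ (inj₂ (∈-toSubset⁺ x∈xs))

  ∈-toSubset⁻ : ∀ {x : Fin n} xs → x ∈ₛ toSubset xs → x ∈ xs
  ∈-toSubset⁻ [] x∈∅ = ⊥-elim (∉⊥ x∈∅)
  ∈-toSubset⁻ (y ∷ xs) x∈ with x∈p∪q⁻ ⁅ y ⁆ (toSubset xs) x∈
  ... | inj₁ x∈⁅y⁆ = here (x∈⁅y⁆⇒x≡y y x∈⁅y⁆)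
  ... | inj₂ x∈xs = there (∈-toSubset⁻ xs x∈xs)

  toSubset-cong : ∀ {xs ys : List (Fin n)} → xs ⊆ˡ ys → ys ⊆ˡ xs → toSubset xs ≡ toSubset ys
  toSubset-cong {xs} {ys} xs⊆ys ys⊆xs = ⊆-antisym
    (∈-toSubset⁺ ∘ xs⊆ys ∘ ∈-toSubset⁻ xs) (∈-toSubset⁺ ∘ ys⊆xs ∘ ∈-toSubset⁻ ys)

  toSubset-⊄ : ∀ {xs ys : List (Fin n)} → Unique xs → length xs ≡ length ys →
    ¬ (toSubset xs ⊂ toSubset ys)
  toSubset-⊄ {xs} {ys} u |xs|≡|ys| (xs⊆ys , y , y∈ys , y∉xs) =
    <-irrefl |xs|≡|ys| (Unique-⊆⇒length≤ (All.tabulate y≢ ∷ u) y∷xs⊆ys)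
    where
    y≢ : ∀ {z} → z ∈ xs → y ≢ z
    y≢ z∈xs refl = y∉xs (∈-toSubset⁺ z∈xs)
    y∷xs⊆ys : y ∷ xs ⊆ˡ ys
    y∷xs⊆ys (here refl) = ∈-toSubset⁻ ys y∈ys
    y∷xs⊆ys (there z∈xs) = ∈-toSubset⁻ ys (xs⊆ys (∈-toSubset⁺ z∈xs))

  ⁅⁆-injective : ∀ {x y : Fin n} → ⁅ x ⁆ ≡ ⁅ y ⁆ → x ≡ y
  ⁅⁆-injective {x} {y} eq = x∈⁅y⁆⇒x≡y y (subst (x ∈ₛ_) eq (x∈⁅x⁆ x))

  ⁅x⁆∪-⊆-cancel : ∀ {x : Fin n} {p q} → x ∉ₛ p → ⁅ x ⁆ ∪ p ⊆ ⁅ x ⁆ ∪ q → p ⊆ q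
  ⁅x⁆∪-⊆-cancel {x} {p} {q} x∉p sub {y} y∈p with x∈p∪q⁻ ⁅ x ⁆ q (sub (x∈p∪q⁺ (inj₂ y∈p)))
  ... | inj₁ y∈⁅x⁆ = ⊥-elim (x∉p (subst (_∈ₛ p) (x∈⁅y⁆⇒x≡y x y∈⁅x⁆) y∈p))
  ... | inj₂ y∈q = y∈q

  ⁅x⁆∪-cancel : ∀ {x : Fin n} {p q} → x ∉ₛ p → x ∉ₛ q → ⁅ x ⁆ ∪ p ≡ ⁅ x ⁆ ∪ q → p ≡ q
  ⁅x⁆∪-cancel x∉p x∉q eq = ⊆-antisym
    (⁅x⁆∪-⊆-cancel x∉p (⊆-reflexive eq)) (⁅x⁆∪-⊆-cancel x∉q (⊆-reflexive (sym eq)))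

  ⁅x⁆∪-mono-⊂ : ∀ {x : Fin n} {p q} → x ∉ₛ q → p ⊂ q → ⁅ x ⁆ ∪ p ⊂ ⁅ x ⁆ ∪ q
  ⁅x⁆∪-mono-⊂ {x} {p} {q} x∉q (p⊆q , y , y∈q , y∉p) = ∪-⊆ , y , x∈p∪q⁺ (inj₂ y∈q) , y∉
    where
    ∪-⊆ : ⁅ x ⁆ ∪ p ⊆ ⁅ x ⁆ ∪ q
    ∪-⊆ z∈ = x∈p∪q⁺ (⊎-map id p⊆q (x∈p∪q⁻ ⁅ x ⁆ p z∈))
    y∉ : y ∉ₛ ⁅ x ⁆ ∪ p
    y∉ y∈ with x∈p∪q⁻ ⁅ x ⁆ p y∈
    ... | inj₁ y∈⁅x⁆ = x∉q (subst (_∈ₛ q) (x∈⁅y⁆⇒x≡y x y∈⁅x⁆) y∈q)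
    ... | inj₂ y∈p = y∉p y∈p

-- Flags

module _ {n : ℕ} where

  flag : List (Fin n) → List (Subset n)
  flag [] = []
  flag (x ∷ xs) = ⁅ x ⁆ ∷ map (⁅ x ⁆ ∪_) (flag xs)

  IsInitialSegment : List (Fin n) → Subset n → Set
  IsInitialSegment ω P = ∃₂ λ x xs → ∃[ ys ] (ω ≡ x ∷ xs ++ ys × P ≡ toSubset (x ∷ xs))

  ∈-flag⁺ : ∀ {ω P} → IsInitialSegment ω P → P ∈ flag ω
  ∈-flag⁺ (x , [] , ys , refl , refl) = here (∪-identityʳ ⁅ x ⁆)
  ∈-flag⁺ (x , y ∷ xs , ys , refl , refl) =
    there (∈-map⁺ (⁅ x ⁆ ∪_) (∈-flag⁺ (y , xs , ys , refl , refl)))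

  ∈-flag⁻ : ∀ {ω P} → P ∈ flag ω → IsInitialSegment ω P
  ∈-flag⁻ {x ∷ xs} (here refl) = x , [] , xs , refl , sym (∪-identityʳ ⁅ x ⁆)
  ∈-flag⁻ {x ∷ xs} (there P∈) with ∈-map⁻ (⁅ x ⁆ ∪_) P∈
  ... | Q , Q∈ , refl with ∈-flag⁻ Q∈
  ... | y , ys , zs , refl , refl = x , y ∷ ys , zs , refl , refl

  take∈flag : ∀ {k} (ω : List (Fin n)) → 1 ≤ k → k ≤ length ω → toSubset (take k ω) ∈ flag ω
  take∈flag {suc k} (x ∷ ω) _ _ =
    ∈-flag⁺ (x , take k ω , drop k ω , cong (x ∷_) (sym (take++drop≡id k ω)) , refl)

  ∈-flag⇒∈ : ∀ {ω P y} → P ∈ flag ω → y ∈ₛ P → y ∈ ω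
  ∈-flag⇒∈ P∈ y∈P with ∈-flag⁻ P∈
  ... | x , xs , ys , refl , refl = ∈-++⁺ˡ {xs = x ∷ xs} (∈-toSubset⁻ (x ∷ xs) y∈P)

  ∉-flag : ∀ {x xs} → Unique (x ∷ xs) → All (x ∉ₛ_) (flag xs)
  ∉-flag (x∉xs ∷ _) = All.tabulate λ P∈ x∈P → All.lookup x∉xs (∈-flag⇒∈ P∈ x∈P) refl

  ⁅x⁆∪-linked : ∀ {x : Fin n} {ps} → All (x ∉ₛ_) ps → Linked _⊂_ ps →
    Linked _⊂_ (map (⁅ x ⁆ ∪_) ps)
  ⁅x⁆∪-linked [] [] = []
  ⁅x⁆∪-linked (_ ∷ []) [-] = [-]
  ⁅x⁆∪-linked (_ ∷ x∉q ∷ x∉ps) (p⊂q ∷ linked) =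
    ⁅x⁆∪-mono-⊂ x∉q p⊂q ∷ ⁅x⁆∪-linked (x∉q ∷ x∉ps) linked

  flag-linked : ∀ {ω : List (Fin n)} → Unique ω → Linked _⊂_ (flag ω)
  flag-linked {[]} _ = []
  flag-linked {x ∷ []} _ = [-]
  flag-linked {x ∷ y ∷ ys} u@(x∉ ∷ u′) =
    (p⊆p∪q ⁅ y ⁆ , y , x∈p∪q⁺ (inj₂ (x∈⁅x⁆ y)) , x≢y⇒x∉⁅y⁆ (All.lookup x∉ (here refl) ∘ sym))
    ∷ ⁅x⁆∪-linked (∉-flag u) (flag-linked u′)

  flag-injective : ∀ {ω ω′ : List (Fin n)} → Unique ω → Unique ω′ → flag ω ≡ flag ω′ → ω ≡ ω′
  flag-injective {[]} {[]} _ _ _ = refl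
  flag-injective {x ∷ xs} {y ∷ ys} u@(_ ∷ uxs) u′@(_ ∷ uys) eq with ∷-injective eq
  ... | ⁅x⁆≡⁅y⁆ , eq′ with ⁅⁆-injective ⁅x⁆≡⁅y⁆
  ... | refl = cong (x ∷_)
    (flag-injective uxs uys (map-injective-on ⁅x⁆∪-cancel (∉-flag u) (∉-flag u′) eq′))

  ∈-flag⇒InV : ∀ {D : Domain n} {ω P} → ω ∈ D → length ω ≡ n → P ∈ flag ω → InV D P
  ∈-flag⇒InV {ω = ω} ω∈D length≡n P∈ with ∈-flag⁻ P∈
  ... | x , xs , ys , refl , refl =
    ω , ω∈D , length (x ∷ xs) , s≤s z≤n ,
    subst (length (x ∷ xs) ≤_) length≡n (length-++-≤ˡ (x ∷ xs)) ,
    cong toSubset (sym (take-length-++ (x ∷ xs) ys))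

  take-⊄-take : ∀ {ω ν : Pref n} {k} → IsPref ω → IsPref ν → k ≤ n →
    ¬ (toSubset (take k ω) ⊂ toSubset (take k ν))
  take-⊄-take {ω} {ν} {k} (|ω|≡n , uω) (|ν|≡n , _) k≤n =
    toSubset-⊄ {ys = take k ν} (Unique.take⁺ k uω) (trans (|take| |ω|≡n) (sym (|take| {ν} |ν|≡n)))
    where
    |take| : ∀ {ω′ : Pref n} → length ω′ ≡ n → length (take k ω′) ≡ k
    |take| {ω′} |ω′|≡n = length-take-≤ k ω′ (subst (k ≤_) (sym |ω′|≡n) k≤n)

-- Grafting

module _ {n : ℕ} where

  open DecMembership (_≟_ {n}) using (_∈?_)

  graft : ℕ → Pref n → Pref n → Pref n
  graft k ω ν = restrict (take k ν) ω ++ drop k ν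

  restrict⊆ : ∀ (T ω : List (Fin n)) → restrict T ω ⊆ˡ T
  restrict⊆ T ω = proj₂ ∘ ∈-filter⁻ (_∈? T) {xs = ω}

  ⊆restrict : ∀ {T ω : List (Fin n)} → (∀ x → x ∈ ω) → T ⊆ˡ restrict T ω
  ⊆restrict {T} ω-complete {x} = ∈-filter⁺ (_∈? T) (ω-complete x)

  length-restrict : ∀ {T ω : List (Fin n)} → Unique T → Unique ω → (∀ x → x ∈ ω) →
    length (restrict T ω) ≡ length T
  length-restrict {T} {ω} uT uω ω-complete = ≤-antisym
    (Unique-⊆⇒length≤ (Unique.filter⁺ (_∈? T) uω) (restrict⊆ T ω))
    (Unique-⊆⇒length≤ uT (⊆restrict ω-complete))

  graft-IsPref : ∀ k {ω ν} → IsPref ω → IsPref ν → IsPref (graft k ω ν)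
  graft-IsPref k {ω} {ν} pω@(_ , uω) (|ν|≡n , uν) =
    |graft|≡n , Unique.++⁺ (Unique.filter⁺ (_∈? T) uω) (Unique.drop⁺ k uν) disjoint
    where
    open ≡-Reasoning
    T = take k ν
    |R|≡|T| : length (restrict T ω) ≡ length T
    |R|≡|T| = length-restrict (Unique.take⁺ k uν) uω (IsPref⇒∈ pω)
    |graft|≡n : length (graft k ω ν) ≡ n
    |graft|≡n = begin
      length (restrict T ω ++ drop k ν)          ≡⟨ length-++ (restrict T ω) ⟩
      length (restrict T ω) + length (drop k ν)  ≡⟨ cong (_+ length (drop k ν)) |R|≡|T| ⟩
      length T + length (drop k ν)               ≡⟨ length-++ T ⟨
      length (T ++ drop k ν)                     ≡⟨ cong length (take++drop≡id k ν) ⟩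
      length ν                                   ≡⟨ |ν|≡n ⟩
      n                                          ∎
    disjoint : Disjoint (restrict T ω) (drop k ν)
    disjoint (v∈R , v∈drop) = Unique-++⇒Disjoint (subst Unique (sym (take++drop≡id k ν)) uν)
                                (restrict⊆ T ω v∈R , v∈drop)

  graft-flag : ∀ {k ω ν} → IsPref ω → IsPref ν → 1 ≤ k → k ≤ n →
    toSubset (take k ν) ∈ flag (graft k ω ν)
  graft-flag {k} {ω} {ν} pω pν@(|ν|≡n , uν) 1≤k k≤n =
    subst (_∈ flag (graft k ω ν)) toSubset-take≡
      (take∈flag (graft k ω ν) 1≤k (subst (k ≤_) (sym (proj₁ (graft-IsPref k pω pν))) k≤n))
    where
    open ≡-Reasoning
    T = take k ν
    R = restrict T ω
    |R|≡k : length R ≡ k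
    |R|≡k = trans (length-restrict (Unique.take⁺ k uν) (proj₂ pω) (IsPref⇒∈ pω))
                  (length-take-≤ k ν (subst (k ≤_) (sym |ν|≡n) k≤n))
    toSubset-take≡ : toSubset (take k (R ++ drop k ν)) ≡ toSubset T
    toSubset-take≡ = begin
      toSubset (take k (R ++ drop k ν))
        ≡⟨ cong (λ j → toSubset (take j (R ++ drop k ν))) |R|≡k ⟨
      toSubset (take (length R) (R ++ drop k ν))
        ≡⟨ cong toSubset (take-length-++ R (drop k ν)) ⟩
      toSubset R
        ≡⟨ toSubset-cong (restrict⊆ T ω) (⊆restrict (IsPref⇒∈ pω)) ⟩
      toSubset T
        ∎

  graft-keeps-flag : ∀ {k ω ν P} → P ∈ flag ω → P ⊆ toSubset (take k ν) →
    P ∈ flag (graft k ω ν)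
  graft-keeps-flag {k} {ω} {ν} P∈ P⊆T with ∈-flag⁻ P∈
  ... | x , xs , ys , refl , refl = ∈-flag⁺ (x , xs , restrict T ys ++ drop k ν , graft≡ , refl)
    where
    open ≡-Reasoning
    T = take k ν
    x∷xs⊆T : All (_∈ T) (x ∷ xs)
    x∷xs⊆T = All.tabulate λ z∈ → ∈-toSubset⁻ T (P⊆T (∈-toSubset⁺ z∈))
    graft≡ : graft k (x ∷ xs ++ ys) ν ≡ x ∷ xs ++ (restrict T ys ++ drop k ν)
    graft≡ = begin
      restrict T ((x ∷ xs) ++ ys) ++ drop k ν
        ≡⟨ cong (_++ drop k ν) (filter-++ (_∈? T) (x ∷ xs) ys) ⟩
      (restrict T (x ∷ xs) ++ restrict T ys) ++ drop k ν
        ≡⟨ cong (λ l → (l ++ restrict T ys) ++ drop k ν) (filter-all (_∈? T) x∷xs⊆T) ⟩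
      ((x ∷ xs) ++ restrict T ys) ++ drop k ν
        ≡⟨ ++-assoc (x ∷ xs) (restrict T ys) (drop k ν) ⟩
      x ∷ xs ++ (restrict T ys ++ drop k ν)
        ∎

  IsBottom : List (Fin n) → Pref n → Fin n → Set
  IsBottom X ω w = ∃[ pre ] restrict X ω ≡ pre ++ [ w ]

  graft-bottom : ∀ k {X ω ν w} → (∀ x → x ∈ ν) → IsBottom X (graft k ω ν) w →
    IsBottom X ω w ⊎ IsBottom X ν w
  graft-bottom k {X} {ω} {ν} {w} ν-complete (pre , eq) =
    ⊎-map bottom-of-ω bottom-of-ν
      (++-∷ʳ-suffix (restrict X R) (restrict X (drop k ν)) pre
        (trans (sym (filter-++ (_∈? X) R (drop k ν))) eq))
    where
    open ≡-Reasoning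
    T = take k ν
    R = restrict T ω
    X⊆T : restrict X (drop k ν) ≡ [] → ∀ {y} → y ∈ X → y ∈ T
    X⊆T none {y} y∈X with ∈-++⁻ T (subst (y ∈_) (sym (take++drop≡id k ν)) (ν-complete y))
    ... | inj₁ y∈T = y∈T
    ... | inj₂ y∈drop with subst (y ∈_) none (∈-filter⁺ (_∈? X) y∈drop y∈X)
    ...   | ()
    bottom-of-ω : restrict X (drop k ν) ≡ [] → IsBottom X ω w
    bottom-of-ω none = pre , (begin
      restrict X ω                           ≡⟨ filter-filter (_∈? X) (_∈? T) (X⊆T none) ω ⟨
      restrict X R                           ≡⟨ ++-identityʳ (restrict X R) ⟨
      restrict X R ++ []                     ≡⟨ cong (restrict X R ++_) none ⟨
      restrict X R ++ restrict X (drop k ν)  ≡⟨ filter-++ (_∈? X) R (drop k ν) ⟨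
      restrict X (graft k ω ν)               ≡⟨ eq ⟩
      pre ++ [ w ]                           ∎)
    bottom-of-ν : ∃[ ys ] restrict X (drop k ν) ≡ ys ∷ʳ w → IsBottom X ν w
    bottom-of-ν (ys , last) = restrict X T ++ ys , (begin
      restrict X ν                           ≡⟨ cong (restrict X) (take++drop≡id k ν) ⟨
      restrict X (T ++ drop k ν)             ≡⟨ filter-++ (_∈? X) T (drop k ν) ⟩
      restrict X T ++ restrict X (drop k ν)  ≡⟨ cong (restrict X T ++_) last ⟩
      restrict X T ++ ys ∷ʳ w                ≡⟨ ++-assoc (restrict X T) ys [ w ] ⟨
      (restrict X T ++ ys) ∷ʳ w              ∎)

-- Maximal ASPDs and their maximal chains

module _ {n : ℕ} where

  maximalASPD-absorbs : ∀ {D : Domain n} {ω} → IsMaximalASPD D → IsPref ω →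
    (∀ X w → IsBottom X ω w → IsBottomOfRestriction D X w) → ω ∈ D
  maximalASPD-absorbs {D} {ω} (isDomain , isASPD , maximal) pω bottoms =
    maximal (ω ∷ D) isDomain′ isASPD′ (λ _ → there) ω (here refl)
    where
    isDomain′ : IsDomain (ω ∷ D)
    isDomain′ _ (here refl) = pω
    isDomain′ ω′ (there ω′∈D) = isDomain ω′ ω′∈D
    isASPD′ : IsASPD (ω ∷ D)
    isASPD′ x y z x≢y x≢z y≢z with isASPD x y z x≢y x≢z y≢z
    ... | w , w∈ , ¬bottom = w , w∈ , λ where
      (_ , here refl , bottom) → ¬bottom (bottoms _ w bottom)
      (ω′ , there ω′∈D , bottom) → ¬bottom (ω′ , ω′∈D , bottom)

  StartsWith : Fin n → Pref n → Set
  StartsWith a ω = ∃[ ω′ ] ω ≡ a ∷ ω′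

  startsWith? : (a : Fin n) → Decidable (StartsWith a)
  startsWith? a [] = no λ { (_ , ()) }
  startsWith? a (x ∷ ω) = map′ (λ { refl → ω , refl }) (λ { (_ , refl) → refl }) (x ≟ a)

  topCount≡length-filter : ∀ a (D : Domain n) → topCount a D ≡ length (filter (startsWith? a) D)
  topCount≡length-filter a [] = refl
  topCount≡length-filter a ([] ∷ D) = topCount≡length-filter a D
  topCount≡length-filter a ((x ∷ _) ∷ D) with x ≟ a
  ... | yes _ = cong suc (topCount≡length-filter a D)
  ... | no _ = topCount≡length-filter a D

module _ {n : ℕ} {D : Domain n} (maxD : IsMaximalASPD D) where

  private
    isPref : ∀ {ω} → ω ∈ D → IsPref ω
    isPref = proj₁ maxD _

    sorted : ∀ {c : List (Subset n)} → Linked _⊂_ c → AllPairs _⊂_ c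
    sorted = Linked⇒AllPairs ⊂-trans

  graft-∈ : ∀ k {ω ν} → ω ∈ D → ν ∈ D → graft k ω ν ∈ D
  graft-∈ k {ω} {ν} ω∈D ν∈D =
    maximalASPD-absorbs maxD (graft-IsPref k (isPref ω∈D) (isPref ν∈D)) bottoms
    where
    bottoms : ∀ X w → IsBottom X (graft k ω ν) w → IsBottomOfRestriction D X w
    bottoms X w = [ (λ b → ω , ω∈D , b) , (λ b → ν , ν∈D , b) ]′
                ∘ graft-bottom k {X} {ω} {ν} (IsPref⇒∈ (isPref ν∈D))

  flag-IsChain : ∀ {ω} → ω ∈ D → IsChain D (flag ω)
  flag-IsChain ω∈D =
    (λ _ → ∈-flag⇒InV ω∈D (proj₁ (isPref ω∈D))) , flag-linked (proj₂ (isPref ω∈D))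

  flag-maximal : ∀ {ω} → ω ∈ D → ∀ c → IsChain D c → (∀ S → S ∈ flag ω → S ∈ c) →
    ∀ S → S ∈ c → S ∈ flag ω
  flag-maximal {ω} ω∈D c (inV , linked) flag⊆c S S∈c with inV S S∈c
  ... | ν , ν∈D , k , 1≤k , k≤n , refl =
    from-comparable (AllPairs⇒comparable (sorted linked) S∈c (flag⊆c F F∈flag))
    where
    F = toSubset (take k ω)
    F∈flag : F ∈ flag ω
    F∈flag = take∈flag ω 1≤k (subst (k ≤_) (sym (proj₁ (isPref ω∈D))) k≤n)
    from-comparable : S ≡ F ⊎ S ⊂ F ⊎ F ⊂ S → S ∈ flag ω
    from-comparable (inj₁ S≡F) = subst (_∈ flag ω) (sym S≡F) F∈flag
    from-comparable (inj₂ (inj₁ S⊂F)) = ⊥-elim (take-⊄-take (isPref ν∈D) (isPref ω∈D) k≤n S⊂F)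
    from-comparable (inj₂ (inj₂ F⊂S)) = ⊥-elim (take-⊄-take (isPref ω∈D) (isPref ν∈D) k≤n F⊂S)

  -- The last component is what makes the induction go through: grafting at the next member
  -- S of the chain keeps every initial segment contained in S.
  chain⊆flag : ∀ c → AllPairs _⊂_ c → (∀ S → S ∈ c → InV D S) → ∀ {ω} → ω ∈ D →
    ∃[ ω′ ] (ω′ ∈ D × (∀ S → S ∈ c → S ∈ flag ω′)
                    × (∀ P → P ∈ flag ω → All (P ⊆_) c → P ∈ flag ω′))
  chain⊆flag [] _ _ {ω} ω∈D = ω , ω∈D , (λ _ ()) , (λ _ P∈ _ → P∈)
  chain⊆flag (S ∷ c) (S⊂c ∷ c-sorted) inV {ω} ω∈D with inV S (here refl)
  ... | ν , ν∈D , k , 1≤k , k≤n , refl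
    with chain⊆flag c c-sorted (λ S′ → inV S′ ∘ there) (graft-∈ k ω∈D ν∈D)
  ... | ω′ , ω′∈D , c⊆ , keeps = ω′ , ω′∈D , S∷c⊆ , keeps′
    where
    S∷c⊆ : ∀ S′ → S′ ∈ S ∷ c → S′ ∈ flag ω′
    S∷c⊆ _ (here refl) =
      keeps S (graft-flag (isPref ω∈D) (isPref ν∈D) 1≤k k≤n) (All.map proj₁ S⊂c)
    S∷c⊆ S′ (there S′∈c) = c⊆ S′ S′∈c
    keeps′ : ∀ P → P ∈ flag ω → All (P ⊆_) (S ∷ c) → P ∈ flag ω′
    keeps′ P P∈ (P⊆S ∷ P⊆c) = keeps P (graft-keeps-flag P∈ P⊆S) P⊆c

  maximalChain≡flag : ∀ {c ω} → IsMaximalChain D c → ω ∈ D → ∃[ ω′ ] (ω′ ∈ D × c ≡ flag ω′)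
  maximalChain≡flag {c} ((inV , linked) , maximal) ω∈D with chain⊆flag c (sorted linked) inV ω∈D
  ... | ω′ , ω′∈D , c⊆flag , _ =
    ω′ , ω′∈D ,
    strictlySorted-≡ ⊂-irref ⊂-trans (sorted linked) (sorted (proj₂ (flag-IsChain ω′∈D)))
      c⊆flag (maximal (flag ω′) (flag-IsChain ω′∈D) c⊆flag)

  maximalChainFrom≡flag : ∀ {a c} → IsMaximalChainFrom D a c →
    ∃[ ω ] (ω ∈ D × StartsWith a ω × c ≡ flag ω)
  maximalChainFrom≡flag {a} (isMax@((inV , _) , _) , _ , refl) with inV ⁅ a ⁆ (here refl)
  ... | ν , ν∈D , _ with maximalChain≡flag isMax ν∈D
  ... | x ∷ ω , ω∈D , eq with ⁅⁆-injective (proj₁ (∷-injective eq))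
  ... | refl = a ∷ ω , ω∈D , (ω , refl) , eq

  flag-IsMaximalChainFrom : ∀ {a ω} → a ∷ ω ∈ D → IsMaximalChainFrom D a (flag (a ∷ ω))
  flag-IsMaximalChainFrom ω∈D = (flag-IsChain ω∈D , flag-maximal ω∈D) , _ , refl

proposition5p2 : (n : ℕ) (D : Domain n) → Unique D → IsMaximalASPD D →
    (a : Fin n) → HasCount (IsMaximalChainFrom D a) (topCount a D)
proposition5p2 n D uniqueD maxD a =
  map flag D₍a₎ ,
  Unique-map⁺-on flag-injective prefs (Unique.filter⁺ (startsWith? a) uniqueD) ,
  (λ c → mk⇔ (sound c) (complete c)) ,
  trans (length-map flag D₍a₎) (sym (topCount≡length-filter a D))
  where
  D₍a₎ : Domain n
  D₍a₎ = filter (startsWith? a) D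
  prefs : All Unique D₍a₎
  prefs = All.tabulate (proj₂ ∘ proj₁ maxD _ ∘ proj₁ ∘ ∈-filter⁻ (startsWith? a) {xs = D})
  sound : ∀ c → c ∈ map flag D₍a₎ → IsMaximalChainFrom D a c
  sound c c∈ with ∈-map⁻ flag c∈
  ... | ω , ω∈D₍a₎ , refl with ∈-filter⁻ (startsWith? a) {xs = D} ω∈D₍a₎
  ... | ω∈D , (_ , refl) = flag-IsMaximalChainFrom maxD ω∈D
  complete : ∀ c → IsMaximalChainFrom D a c → c ∈ map flag D₍a₎
  complete c isMax with maximalChainFrom≡flag maxD isMax
  ... | ω , ω∈D , startsWithA , refl = ∈-map⁺ flag (∈-filter⁺ (startsWith? a) ω∈D startsWithA)
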